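{- Let $n\ge1$ and $\tau\in\mathcal B_n$. If the graph $\hat\tau$ is a single cycle, then $\tau$ has exactly two principal colorings, and in each of them every vertex $v_i$ with $i$ odd has the opposite color from every vertex $v_{i'}$ with $i'$ even.
   Context: Place $2n$ vertices in two columns: the left column $v_1,\dotsc,v_n$ from bottom to top and the right column $v_{n+1},\dotsc,v_{2n}$ from top to bottom (labels increase clockwise from the lower left), so $v_i$ and $v_{2n+1-i}$ lie at the same height $i$. The Temperley–Lieb algebra $T_n(\xi)$ is the $\mathbb C$-algebra generated by $t_1,\dotsc,t_{n-1}$ with relations $t_i^2=\xi t_i$, $t_it_jt_i=t_i$ if $|i-j|=1$, $t_it_j=t_jt_i$ if $|i-j|\ge2$. $\mathcal B_n$ is the multiplicative monoid generated by $t_1,\dots,t_{n-1}$ when $\xi=1$; it is a basis of $T_n(\xi)$. Each $\tau\in\mathcal B_n$ is identified with its Kauffman diagram, a noncrossing perfect matching of the $2n$ vertices drawn in the strip between the columns: the identity has edges $v_i$—$v_{2n+1-i}$ for all $i$; $t_i$ has edges $v_i$—$v_{i+1}$, $v_{2n+1-i}$—$v_{2n-i}$, and $v_k$—$v_{2n+1-k}$ for $k\ne i,i+1$; a product corresponds to concatenating diagrams side by side (identifying right vertices of the left factor with left vertices of the right factor at equal heights), closed loops being removed. $\hat\tau$ is the multigraph obtained from $\tau$ by adding an edge $v_i$—$v_{2n+1-i}$ for each $i\in[n]$ (even if such an edge already exists); every vertex has degree 2, so $\hat\tau$ is a disjoint union of cycles. A principal coloring of $\tau$ is a map from the $2n$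 vertices to $\{\text{black},\text{white}\}$ that is a proper coloring of $\hat\tau$, i.e. $v_i$ and $v_{2n+1-i}$ get different colors for each $i\in[n]$, and adjacent vertices of $\tau$ get different colors. -}

module Defs where

open import Data.Nat using (ℕ; zero; suc; _*_; _∸_; _%_)
open import Data.Fin using (Fin; toℕ)
import Data.Fin as F
open import Data.Bool using (Bool; true; false; if_then_else_; _∧_; not)
open import Data.Product using (_×_; _,_)
open import Data.Sum using (_⊎_)
open import Relation.Nullary using (¬_)
open import Relation.Nullary.Decidable using (⌊_⌋)
open import Relation.Binary.PropositionalEquality using (_≡_)
open import Relation.Binary.Construct.Closure.ReflexiveTransitive using (Star)

-- Vertices: (left , k) is v_{k+1} (left column, height k+1);
-- (right , k) is v_{2n-k} = v_{2n+1-(k+1)} (right column, height k+1).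
data Side : Set where
  left right : Side

Vertex : ℕ → Set
Vertex n = Side × Fin n

label : ∀ {n} → Vertex n → ℕ
label (left , k) = suc (toℕ k)
label {n} (right , k) = (2 * n) ∸ toℕ k

sameSide : Side → Side → Bool
sameSide left left = true
sameSide right right = true
sameSide _ _ = false

eqV : ∀ {n} → Vertex n → Vertex n → Bool
eqV (s , k) (s' , k') = sameSide s s' ∧ ⌊ k F.≟ k' ⌋

-- A diagram (perfect matching) is given by its partner function.
Diagram : ℕ → Set
Diagram n = Vertex n → Vertex n

-- the extra edge v_i — v_{2n+1-i} of τ̂ (same height, other column)
rung : ∀ {n} → Vertex n → Vertex n
rung (left , k) = (right , k)
rung (right , k) = (left , k)

identity : ∀ {n} → Diagram n
identity = rung

-- Right multiplication τ · t_i, where the generator t_i is given by the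
-- heights a+1 = i and b+1 = i+1 (so toℕ b ≡ suc (toℕ a)).
-- Concatenation: right vertices of τ glued to left vertices of t_i;
-- closed loops removed.
mulT : ∀ {n} → Diagram n → Fin n → Fin n → Diagram n
mulT τ a b x =
  if eqV x (right , a) then (right , b) else
  if eqV x (right , b) then (right , a) else
  (if eqV (τ x) (right , a) then τ (right , b) else
   if eqV (τ x) (right , b) then τ (right , a) else τ x)

-- 𝓑_n : the monoid generated by t_1 … t_{n-1} (ξ = 1), as diagrams.
data InB {n : ℕ} : Diagram n → Set where
  B-id : InB identity
  B-mul : ∀ {τ} → InB τ → (a b : Fin n) → toℕ b ≡ suc (toℕ a) →
          InB (mulT τ a b)

AdjHat : ∀ {n} → Diagram n → Vertex n → Vertex n → Set
AdjHat τ x y = (τ x ≡ y) ⊎ (rung x ≡ y)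

-- τ̂ (2-regular, every vertex of degree 2) is a single cycle,
-- i.e. it is connected.
SingleCycle : ∀ {n} → Diagram n → Set
SingleCycle {n} τ = (x y : Vertex n) → Star (AdjHat τ) x y

Coloring : ℕ → Set
Coloring n = Vertex n → Bool

Principal : ∀ {n} → Diagram n → Coloring n → Set
Principal {n} τ c = ((x : Vertex n) → ¬ (c (rung x) ≡ c x)) ×
                    ((x : Vertex n) → ¬ (c (τ x) ≡ c x))

-- Every edge of a diagram in 𝓑_n joins labels of opposite parity: this holds for the
-- identity, and right multiplication by t_i only rewires edges through the vertices
-- v_{2n+1-i} and v_{2n-i}, whose labels have opposite parity.  The rungs of τ̂ join
-- v_i to v_{2n+1-i}, again of opposite parity, so colouring by parity of the label is
-- principal, and so is its complement.  On a connected graph two proper 2-colourings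
-- either agree everywhere or disagree everywhere, hence there are no others.
{-# OPTIONS --safe #-}
module Submission where

open import Defs
open import Level using (Level; _⊔_)
open import Data.Nat using (ℕ; _≤_; _%_; suc; _+_; _*_; _∸_; _/_; parity)
open import Data.Nat.Properties using (≤-trans; m≤m+n; <⇒≤; m+[n∸m]≡n)
open import Data.Nat.DivMod using (m≡m%n+[m/n]*n)
open import Data.Parity using (Parity; 0ℙ; 1ℙ; _⁻¹)
import Data.Parity as ℙ
open import Data.Parity.Properties
  using (⁻¹-involutive; p+p≡0ℙ; +-assoc; +-cancelˡ-≡; +-homo-+; *-homo-*; *-zeroʳ; +-identityʳ)
open import Data.Fin using (Fin; toℕ; zero)
open import Data.Fin.Properties using (toℕ<n)
open import Data.Bool using (Bool; true; false; not)
open import Data.Bool.Properties using (¬-not; not-¬; not-injective; T-≡) renaming (_≟_ to _≟ᵇ_)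
open import Data.Product using (_×_; ∃-syntax; _,_)
open import Data.Sum using (_⊎_; inj₁; inj₂)
open import Function using (_∘_; Equivalence)
open import Relation.Binary.Core using (Rel)
open import Relation.Nullary using (¬_; yes; no; contradiction)
open import Relation.Nullary.Decidable using (toWitness)
open import Relation.Binary.PropositionalEquality
open import Relation.Binary.Construct.Closure.ReflexiveTransitive using (Star; ε; _◅_)

module _ {a ℓ : Level} {V : Set a} (R : Rel V ℓ) where

  ProperColoring : (V → Bool) → Set (a ⊔ ℓ)
  ProperColoring c = ∀ {x y} → R x y → c x ≢ c y

module _ {a : Level} {V : Set a} where

  AgreeOrComplement : (V → Bool) → (V → Bool) → Set a
  AgreeOrComplement c d = (∀ v → c v ≡ d v) ⊎ (∀ v → c v ≡ not (d v))

  agreeOrComplement-preserves-≢ : ∀ {c d v w} → AgreeOrComplement c d → d v ≢ d w → c v ≢ c w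
  agreeOrComplement-preserves-≢ (inj₁ c≡d) dv≢dw cv≡cw =
    dv≢dw (trans (sym (c≡d _)) (trans cv≡cw (c≡d _)))
  agreeOrComplement-preserves-≢ (inj₂ c≡¬d) dv≢dw cv≡cw =
    dv≢dw (not-injective (trans (sym (c≡¬d _)) (trans cv≡cw (c≡¬d _))))

module _ {a ℓ : Level} {V : Set a} {R : Rel V ℓ} where

  ProperColoring-step : ∀ {c x y} → ProperColoring R c → R x y → c y ≡ not (c x)
  ProperColoring-step proper r = ¬-not (λ e → proper r (sym e))

  ProperColoring-not : ∀ {c} → ProperColoring R c → ProperColoring R (not ∘ c)
  ProperColoring-not proper r = proper r ∘ not-injective

  agreement-propagates : ∀ {c d x y} → ProperColoring R c → ProperColoring R d →
                         Star R x y → c x ≡ d x → c y ≡ d y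
  agreement-propagates _ _ ε cx≡dx = cx≡dx
  agreement-propagates {c} {d} {x} pc pd (r ◅ path) cx≡dx =
    agreement-propagates pc pd path (begin
      c _      ≡⟨ ProperColoring-step pc r ⟩
      not (c x) ≡⟨ cong not cx≡dx ⟩
      not (d x) ≡⟨ ProperColoring-step pd r ⟨
      d _      ∎)
    where open ≡-Reasoning

  connected⇒agreeOrComplement : ∀ {c d} → (∀ x y → Star R x y) → V →
                                ProperColoring R c → ProperColoring R d → AgreeOrComplement c d
  connected⇒agreeOrComplement {c} {d} connected x₀ pc pd with c x₀ ≟ᵇ d x₀
  ... | yes agree = inj₁ λ v → agreement-propagates pc pd (connected x₀ v) agree
  ... | no differ = inj₂ λ v →
    agreement-propagates pc (ProperColoring-not pd) (connected x₀ v) (¬-not differ)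

parity-suc : ∀ m → parity (suc m) ≡ parity m ⁻¹
parity-suc m = +-homo-+ 1 m

parity-∸ : ∀ {m n} → m ≤ n → parity (n ∸ m) ≡ parity m ℙ.+ parity n
parity-∸ {m} {n} m≤n = +-cancelˡ-≡ (parity m) _ _ (begin
  parity m ℙ.+ parity (n ∸ m)              ≡⟨ +-homo-+ m (n ∸ m) ⟨
  parity (m + (n ∸ m))                     ≡⟨ cong parity (m+[n∸m]≡n m≤n) ⟩
  parity n                                 ≡⟨ cong (ℙ._+ parity n) (p+p≡0ℙ (parity m)) ⟨
  (parity m ℙ.+ parity m) ℙ.+ parity n     ≡⟨ +-assoc (parity m) (parity m) (parity n) ⟩
  parity m ℙ.+ (parity m ℙ.+ parity n)     ∎)
  where open ≡-Reasoning

parity-%2 : ∀ m → parity m ≡ parity (m % 2)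
parity-%2 m = begin
  parity m                                   ≡⟨ cong parity (m≡m%n+[m/n]*n m 2) ⟩
  parity (m % 2 + m / 2 * 2)                 ≡⟨ +-homo-+ (m % 2) (m / 2 * 2) ⟩
  parity (m % 2) ℙ.+ parity (m / 2 * 2)      ≡⟨ cong (parity (m % 2) ℙ.+_) (*-homo-* (m / 2) 2) ⟩
  parity (m % 2) ℙ.+ (parity (m / 2) ℙ.* 0ℙ) ≡⟨ cong (parity (m % 2) ℙ.+_) (*-zeroʳ (parity (m / 2))) ⟩
  parity (m % 2) ℙ.+ 0ℙ                      ≡⟨ +-identityʳ (parity (m % 2)) ⟩
  parity (m % 2)                             ∎
  where open ≡-Reasoning

labelParity : ∀ {n} → Vertex n → Parity
labelParity x = parity (label x)

labelParity-left : ∀ {n} (k : Fin n) → labelParity {n} (left , k) ≡ parity (toℕ k) ⁻¹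
labelParity-left k = parity-suc (toℕ k)

labelParity-right : ∀ {n} (k : Fin n) → labelParity {n} (right , k) ≡ parity (toℕ k)
labelParity-right {n} k = begin
  parity (2 * n ∸ toℕ k)                 ≡⟨ parity-∸ (≤-trans (<⇒≤ (toℕ<n k)) (m≤m+n n (n + 0))) ⟩
  parity (toℕ k) ℙ.+ parity (2 * n)      ≡⟨ cong (parity (toℕ k) ℙ.+_) (*-homo-* 2 n) ⟩
  parity (toℕ k) ℙ.+ 0ℙ                  ≡⟨ +-identityʳ (parity (toℕ k)) ⟩
  parity (toℕ k)                         ∎
  where open ≡-Reasoning

OppositeParity : ∀ {n} → Vertex n → Vertex n → Set
OppositeParity x y = labelParity y ≡ labelParity x ⁻¹

OppositeParity-sym : ∀ {n} (x y : Vertex n) → OppositeParity x y → OppositeParity y x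
OppositeParity-sym x y y≡x⁻¹ = begin
  labelParity x          ≡⟨ ⁻¹-involutive (labelParity x) ⟨
  labelParity x ⁻¹ ⁻¹    ≡⟨ cong _⁻¹ y≡x⁻¹ ⟨
  labelParity y ⁻¹       ∎
  where open ≡-Reasoning

OppositeParity-trans₃ : ∀ {n} (x y z w : Vertex n) →
  OppositeParity x y → OppositeParity y z → OppositeParity z w → OppositeParity x w
OppositeParity-trans₃ x y z w xy yz zw = begin
  labelParity w          ≡⟨ zw ⟩
  labelParity z ⁻¹       ≡⟨ cong _⁻¹ yz ⟩
  labelParity y ⁻¹ ⁻¹    ≡⟨ ⁻¹-involutive (labelParity y) ⟩
  labelParity y          ≡⟨ xy ⟩
  labelParity x ⁻¹       ∎
  where open ≡-Reasoning

FlipsParity : ∀ {n} → Diagram n → Set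
FlipsParity {n} τ = (x : Vertex n) → OppositeParity x (τ x)

rung-flipsParity : ∀ {n} → FlipsParity {n} rung
rung-flipsParity (left , k) = OppositeParity-sym (right , k) (left , k) (rung-flipsParity (right , k))
rung-flipsParity (right , k) = begin
  labelParity (left , k)    ≡⟨ labelParity-left k ⟩
  parity (toℕ k) ⁻¹         ≡⟨ cong _⁻¹ (labelParity-right k) ⟨
  labelParity (right , k) ⁻¹ ∎
  where open ≡-Reasoning

adjacent-right-oppositeParity : ∀ {n} {a b : Fin n} → toℕ b ≡ suc (toℕ a) →
                                OppositeParity (right , a) (right , b)
adjacent-right-oppositeParity {a = a} {b} b≡1+a = begin
  labelParity (right , b)    ≡⟨ labelParity-right b ⟩
  parity (toℕ b)             ≡⟨ cong parity b≡1+a ⟩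
  parity (suc (toℕ a))       ≡⟨ parity-suc (toℕ a) ⟩
  parity (toℕ a) ⁻¹          ≡⟨ cong _⁻¹ (labelParity-right a) ⟨
  labelParity (right , a) ⁻¹ ∎
  where open ≡-Reasoning

eqV-sound : ∀ {n} (x y : Vertex n) → eqV x y ≡ true → x ≡ y
eqV-sound (left , k) (left , k') e = cong (left ,_) (toWitness (Equivalence.from T-≡ e))
eqV-sound (right , k) (right , k') e = cong (right ,_) (toWitness (Equivalence.from T-≡ e))
eqV-sound (left , _) (right , _) ()
eqV-sound (right , _) (left , _) ()

mulT-flipsParity : ∀ {n} (τ : Diagram n) (a b : Fin n) → FlipsParity τ →
                   OppositeParity (right , a) (right , b) → FlipsParity (mulT τ a b)
mulT-flipsParity τ a b flips ab x with eqV x (right , a) in x≡a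
... | true rewrite eqV-sound x _ x≡a = ab
... | false with eqV x (right , b) in x≡b
... | true rewrite eqV-sound x _ x≡b = OppositeParity-sym (right , a) (right , b) ab
... | false with eqV (τ x) (right , a) in τx≡a
... | true = OppositeParity-trans₃ x (right , a) (right , b) (τ (right , b))
  (subst (OppositeParity x) (eqV-sound (τ x) _ τx≡a) (flips x)) ab (flips (right , b))
... | false with eqV (τ x) (right , b) in τx≡b
... | true = OppositeParity-trans₃ x (right , b) (right , a) (τ (right , a))
  (subst (OppositeParity x) (eqV-sound (τ x) _ τx≡b) (flips x))
  (OppositeParity-sym (right , a) (right , b) ab) (flips (right , a))
... | false = flips x

InB⇒flipsParity : ∀ {n} {τ : Diagram n} → InB τ → FlipsParity τ
InB⇒flipsParity B-id = rung-flipsParity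
InB⇒flipsParity (B-mul {τ} τ∈B a b b≡1+a) =
  mulT-flipsParity τ a b (InB⇒flipsParity τ∈B) (adjacent-right-oppositeParity b≡1+a)

isOdd : Parity → Bool
isOdd 0ℙ = false
isOdd 1ℙ = true

isOdd-⁻¹ : ∀ p → isOdd (p ⁻¹) ≡ not (isOdd p)
isOdd-⁻¹ 0ℙ = refl
isOdd-⁻¹ 1ℙ = refl

parityColoring : ∀ {n} → Coloring n
parityColoring x = isOdd (labelParity x)

parityColoring-%2 : ∀ {n} (v : Vertex n) → parityColoring v ≡ isOdd (parity (label v % 2))
parityColoring-%2 v = cong isOdd (parity-%2 (label v))

parityColoring-odd≢even : ∀ {n} (v w : Vertex n) → label v % 2 ≡ 1 → label w % 2 ≡ 0 →
                          parityColoring v ≢ parityColoring w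
parityColoring-odd≢even v w v-odd w-even v≡w = contradiction (begin
  true                           ≡⟨ cong (isOdd ∘ parity) v-odd ⟨
  isOdd (parity (label v % 2))   ≡⟨ parityColoring-%2 v ⟨
  parityColoring v               ≡⟨ v≡w ⟩
  parityColoring w               ≡⟨ parityColoring-%2 w ⟩
  isOdd (parity (label w % 2))   ≡⟨ cong (isOdd ∘ parity) w-even ⟩
  false                          ∎) λ ()
  where open ≡-Reasoning

flipsParity⇒recolors : ∀ {n} (f : Diagram n) → FlipsParity f →
                       ∀ x → parityColoring (f x) ≢ parityColoring x
flipsParity⇒recolors f flips x fx≡x =
  not-¬ refl (trans (sym fx≡x) (trans (cong isOdd (flips x)) (isOdd-⁻¹ (labelParity x))))

parityColoring-principal : ∀ {n} (τ : Diagram n) → FlipsParity τ → Principal τ parityColoring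
parityColoring-principal τ flips =
  flipsParity⇒recolors rung rung-flipsParity , flipsParity⇒recolors τ flips

Principal-not : ∀ {n} (τ : Diagram n) {c : Coloring n} → Principal τ c → Principal τ (not ∘ c)
Principal-not _ (rungs , edges) = (λ x → rungs x ∘ not-injective) , (λ x → edges x ∘ not-injective)

Principal⇒proper : ∀ {n} (τ : Diagram n) {c : Coloring n} →
                   Principal τ c → ProperColoring (AdjHat τ) c
Principal⇒proper _ (rungs , edges) (inj₁ refl) = edges _ ∘ sym
Principal⇒proper _ (rungs , edges) (inj₂ refl) = rungs _ ∘ sym

proposition4p1 : (n : ℕ) → 1 ≤ n → (τ : Diagram n) → InB τ → SingleCycle τ →
    (∃[ c₁ ] ∃[ c₂ ] (Principal τ c₁ × Principal τ c₂ × (∃[ v ] ¬ (c₁ v ≡ c₂ v)) ×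
       ((c : Coloring n) → Principal τ c → ((v : Vertex n) → c v ≡ c₁ v) ⊎ ((v : Vertex n) → c v ≡ c₂ v))))
    × ((c : Coloring n) → Principal τ c → (v w : Vertex n) →
         label v % 2 ≡ 1 → label w % 2 ≡ 0 → ¬ (c v ≡ c w))
proposition4p1 (suc m) _ τ τ∈B connected =
  ( parityColoring , not ∘ parityColoring
  , principal , Principal-not τ principal , ((left , zero) , not-¬ refl) , classify )
  , λ c c-principal v w v-odd w-even →
      agreeOrComplement-preserves-≢ (classify c c-principal) (parityColoring-odd≢even v w v-odd w-even)
  where
    principal : Principal τ parityColoring
    principal = parityColoring-principal τ (InB⇒flipsParity τ∈B)

    classify : (c : Coloring (suc m)) → Principal τ c → AgreeOrComplement c parityColoring
    classify c c-principal = connected⇒agreeOrComplement connected (left , zero)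
      (Principal⇒proper τ c-principal) (Principal⇒proper τ principal)
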